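{- Let $F$ be a field and let $B \in F^{n\times n}$ be symmetric. Then the last term of $\operatorname{qpr}(B)$ is ${\tt N}$ or ${\tt A}$, and $\operatorname{rank} B$ is equal to the index of the last ${\tt A}$ or ${\tt S}$ in $\operatorname{qpr}(B)$.
   Context: For an $n\times n$ matrix $B$ and $\alpha,\beta\subseteq\{1,\dots,n\}$, $B[\alpha,\beta]$ denotes the submatrix with rows indexed by $\alpha$ and columns indexed by $\beta$. $B[\alpha,\beta]$ is a quasi-principal submatrix if $|\alpha|=|\beta|$ and $|\alpha|-1\le|\alpha\cap\beta|\le|\alpha|$; its determinant is then a quasi-principal minor of order $|\alpha|$ (so quasi-principal minors are the principal and almost-principal minors). The quasi principal rank characteristic sequence of a symmetric $B\in F^{n\times n}$ is $\operatorname{qpr}(B)=q_1q_2\cdots q_n$, where $q_k={\tt A}$ if all quasi-principal minors of order $k$ are nonzero, $q_k={\tt S}$ if some but not all are nonzero, and $q_k={\tt N}$ if all are zero. -}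

module Defs where

open import Level using (Level; _⊔_)
open import Algebra.Bundles using (CommutativeRing)
open import Data.Nat using (ℕ; zero; suc; _≤_; _∸_)
open import Data.Fin using (Fin; zero; suc; punchIn; cast)
open import Data.Fin.Subset using (Subset; inside; outside; ∣_∣; _∩_; _∈_; _∉_)
open import Data.Vec using (_∷_; [])
open import Data.Product using (Σ; ∃; _×_; _,_)
open import Relation.Binary.PropositionalEquality using (_≡_)
open import Relation.Nullary using (¬_)

record Field (c ℓ : Level) : Set (Level.suc (c ⊔ ℓ)) where
  field
    commutativeRing : CommutativeRing c ℓ
  open CommutativeRing commutativeRing public
  field
    1≉0     : ¬ (1# ≈ 0#)
    inverse : ∀ x → ¬ (x ≈ 0#) → Σ Carrier (λ y → (x * y) ≈ 1#)

module _ {c ℓ : Level} (F : Field c ℓ) where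
  open Field F using (Carrier; _≈_; _+_; _*_; -_; 0#; 1#)

  Matrix : ℕ → ℕ → Set c
  Matrix m n = Fin m → Fin n → Carrier

  IsSymmetric : ∀ {n} → Matrix n n → Set ℓ
  IsSymmetric B = ∀ i j → B i j ≈ B j i

  ∑ : ∀ {n} → (Fin n → Carrier) → Carrier
  ∑ {zero}  f = 0#
  ∑ {suc n} f = f zero + ∑ (λ i → f (suc i))

  sign : ∀ {n} → Fin n → Carrier
  sign zero    = 1#
  sign (suc j) = - sign j

  det : ∀ {n} → Matrix n n → Carrier
  det {zero}  M = 1#
  det {suc n} M = ∑ (λ j → sign j * (M zero j * det (λ i k → M (suc i) (punchIn j k))))

  enum : ∀ {n} (α : Subset n) → Fin ∣ α ∣ → Fin n
  enum (inside ∷ α)  zero    = zero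
  enum (inside ∷ α)  (suc i) = suc (enum α i)
  enum (outside ∷ α) i       = suc (enum α i)

  sub : ∀ {n} → Matrix n n → (α β : Subset n) → Matrix ∣ α ∣ ∣ β ∣
  sub B α β i j = B (enum α i) (enum β j)

  QuasiPrincipal : ∀ {n} → ℕ → Subset n → Subset n → Set
  QuasiPrincipal k α β = (∣ α ∣ ≡ k) × (∣ β ∣ ≡ k) × (k ∸ 1 ≤ ∣ α ∩ β ∣) × (∣ α ∩ β ∣ ≤ k)

  minor : ∀ {n} → Matrix n n → (α β : Subset n) → ∣ α ∣ ≡ ∣ β ∣ → Carrier
  minor B α β e = det (λ i j → sub B α β i (cast e j))

  sizeEq : ∀ {n k} (α β : Subset n) → QuasiPrincipal k α β → ∣ α ∣ ≡ ∣ β ∣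
  sizeEq α β (Relation.Binary.PropositionalEquality.refl , refl₂ , _) =
    Relation.Binary.PropositionalEquality.sym refl₂

  qpMinor : ∀ {n k} → Matrix n n → (α β : Subset n) → QuasiPrincipal k α β → Carrier
  qpMinor B α β q = minor B α β (sizeEq α β q)

  data Letter : Set where
    A S N : Letter

  -- QprTerm B k t  :  q_k = t  in qpr(B)
  QprTerm : ∀ {n} → Matrix n n → ℕ → Letter → Set ℓ
  QprTerm B k A = ∀ α β (q : QuasiPrincipal k α β) → ¬ (qpMinor B α β q ≈ 0#)
  QprTerm B k S = (∃ λ α → ∃ λ β → Σ (QuasiPrincipal k α β) λ q → ¬ (qpMinor B α β q ≈ 0#))
                × (∃ λ α → ∃ λ β → Σ (QuasiPrincipal k α β) λ q → qpMinor B α β q ≈ 0#)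
  QprTerm B k N = ∀ α β (q : QuasiPrincipal k α β) → qpMinor B α β q ≈ 0#

  ColumnsIndependent : ∀ {m n} → Matrix m n → Subset n → Set (c ⊔ ℓ)
  ColumnsIndependent B γ =
    ∀ (x : Fin _ → Carrier) → (∀ j → j ∉ γ → x j ≈ 0#) →
    (∀ i → ∑ (λ j → B i j * x j) ≈ 0#) → ∀ j → x j ≈ 0#

  IsRank : ∀ {m n} → Matrix m n → ℕ → Set (c ⊔ ℓ)
  IsRank B r = (∃ λ γ → ∣ γ ∣ ≡ r × ColumnsIndependent B γ)
             × (∀ γ → ColumnsIndependent B γ → ∣ γ ∣ ≤ r)

module Submission where

-- Two facts about the
-- determinant (defined by Laplace expansion along row 0) drive the theorem:
--   (1) det M ≉ 0 implies that the rows of M are linearly independent;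
--   (2) if M has trivial kernel then det M ≉ 0 (Gaussian elimination).
-- By symmetry, (1) turns a nonzero minor B[α,β] into independence of the columns
-- indexed by α, so no quasi-principal minor of order k > r is nonzero: q_k = N.
-- For a maximal independent set of columns γ (|γ| = r), symmetry and maximality
-- give B[γ,γ] a trivial kernel, so by (2) it is a nonzero principal minor of
-- order r: q_r ∈ {A, S}. Finally q_n ≠ S since B is the only quasi-principal
-- submatrix of order n. Equality in F is not decidable, so "trivial kernel" is
-- stated up to double negation, which suffices for these negative conclusions.

open import Defs
open import Level using (Level; _⊔_)
open import Data.Nat using (ℕ; _≤_; _<_)
open import Data.Sum using (_⊎_; inj₁; inj₂)
open import Data.Product using (_×_; Σ; _,_; proj₁; proj₂)
open import Relation.Binary.PropositionalEquality using (_≡_)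

import Data.Nat as ℕ
import Data.Nat.Properties as ℕP
open import Data.Fin using (Fin; zero; suc; punchIn; cast)
import Data.Fin as Fin
import Data.Fin.Properties as FinP
open import Data.Fin.Subset using (Subset; inside; outside; ∣_∣; _∩_; _∪_; ⁅_⁆; _∈_; _∉_; ⊥)
open import Data.Fin.Subset.Properties using (_∈?_; drop-there; ∩-idem; ∣⊥∣≡0; ∣p∣≡n⇒p≡⊤; p⊂q⇒∣p∣<∣q∣; p⊆p∪q; x∈p∪q⁺; x∈p∪q⁻; x∈⁅x⁆; x∈⁅y⁆⇒x≡y)
open import Data.Vec using ([]; _∷_; here; there)
open import Function using (_∘_)
open import Data.Vec.Functional using (updateAt)
open import Data.List using (List; []; _∷_; allFin)
open import Data.List.Relation.Unary.Any as Any using ()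
open import Data.List.Membership.Propositional using () renaming (_∉_ to _∉ˡ_)
open import Data.List.Membership.Propositional.Properties using (∈-allFin)
open import Data.Vec.Functional.Properties using (updateAt-updates; updateAt-minimal)
open import Relation.Nullary using (¬_; contradiction; yes; no)
import Relation.Binary.PropositionalEquality as Eq

module LinearAlgebra {c ℓ : Level} (F : Field c ℓ) where
  open Field F hiding (zero)
  open import Algebra.Properties.Ring ring using (-‿distribˡ-*; -‿distribʳ-*; -‿involutive; -0#≈0#; +-inverseʳ-unique)
  open import Algebra.Properties.CommutativeMonoid.Sum +-commutativeMonoid
    using (sum; sum-cong-≋; sum-cong-≗; ∑-distrib-+; ∑-comm; sum-remove; sum-replicate-zero)
  open import Algebra.Properties.Semiring.Sum semiring using (*-distribˡ-sum)
  open import Algebra.Solver.Ring.NaturalCoefficients.Default commutativeSemiring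
  open import Relation.Binary.Reasoning.Setoid setoid

  Mat : ℕ → Set c
  Mat n = Matrix F n n

  _·_ : ∀ {n} → (Fin n → Carrier) → (Fin n → Carrier) → Carrier
  u · v = ∑ F (λ j → u j * v j)
  infix 8 _·_

  cancelNonzero : ∀ a b → ¬ (a ≈ 0#) → a * b ≈ 0# → b ≈ 0#
  cancelNonzero a b a≉0 ab≈0 with inverse a a≉0
  ... | a⁻¹ , aa⁻¹≈1 = begin
    b               ≈⟨ *-identityˡ b ⟨
    1# * b          ≈⟨ *-congʳ aa⁻¹≈1 ⟨
    (a * a⁻¹) * b   ≈⟨ solve 3 (λ a a⁻¹ b → (a :* a⁻¹) :* b := a⁻¹ :* (a :* b)) refl a a⁻¹ b ⟩
    a⁻¹ * (a * b)   ≈⟨ *-congˡ ab≈0 ⟩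
    a⁻¹ * 0#        ≈⟨ zeroʳ a⁻¹ ⟩
    0#              ∎

  ∑≡sum : ∀ {n} (f : Fin n → Carrier) → ∑ F f ≡ sum f
  ∑≡sum {ℕ.zero}  f = Eq.refl
  ∑≡sum {ℕ.suc n} f = Eq.cong (f zero +_) (∑≡sum (f ∘ suc))

  ∑-cong : ∀ {n} {f g : Fin n → Carrier} → (∀ i → f i ≈ g i) → ∑ F f ≈ ∑ F g
  ∑-cong {f = f} {g} f≈g rewrite ∑≡sum f | ∑≡sum g = sum-cong-≋ f≈g

  ∑-zero : ∀ {n} (f : Fin n → Carrier) → (∀ i → f i ≈ 0#) → ∑ F f ≈ 0#
  ∑-zero {n} f f≈0 = begin
    ∑ F f                 ≈⟨ ∑-cong f≈0 ⟩
    ∑ F {n} (λ _ → 0#)    ≡⟨ ∑≡sum {n} _ ⟩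
    sum {n} (λ _ → 0#)    ≈⟨ sum-replicate-zero n ⟩
    0#                    ∎

  ∑-+ : ∀ {n} (f g : Fin n → Carrier) → ∑ F (λ i → f i + g i) ≈ ∑ F f + ∑ F g
  ∑-+ f g rewrite ∑≡sum (λ i → f i + g i) | ∑≡sum f | ∑≡sum g = ∑-distrib-+ f g

  ∑-*ˡ : ∀ {n} (a : Carrier) (f : Fin n → Carrier) → ∑ F (λ i → a * f i) ≈ a * ∑ F f
  ∑-*ˡ a f rewrite ∑≡sum (λ i → a * f i) | ∑≡sum f = sym (*-distribˡ-sum a f)

  ∑-swap : ∀ {m n} (f : Fin m → Fin n → Carrier) →
           ∑ F (λ i → ∑ F (f i)) ≈ ∑ F (λ j → ∑ F (λ i → f i j))
  ∑-swap {m} {n} f = begin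
    ∑ F (λ i → ∑ F (f i))             ≡⟨ Eq.trans (∑≡sum {m} _) (sum-cong-≗ (λ i → ∑≡sum (f i))) ⟩
    sum (λ i → sum (f i))             ≈⟨ ∑-comm f ⟩
    sum (λ j → sum (λ i → f i j))     ≡⟨ Eq.trans (∑≡sum {n} _) (sum-cong-≗ (λ j → ∑≡sum (λ i → f i j))) ⟨
    ∑ F (λ j → ∑ F (λ i → f i j))     ∎

  ∑-single : ∀ {n} (f : Fin n → Carrier) (l : Fin n) → (∀ i → ¬ (i ≡ l) → f i ≈ 0#) → ∑ F f ≈ f l
  ∑-single {ℕ.suc n} f l off = begin
    ∑ F f                              ≡⟨ ∑≡sum f ⟩
    sum f                              ≈⟨ sum-remove f ⟩
    f l + sum (f ∘ punchIn l)          ≡⟨ Eq.cong (f l +_) (∑≡sum (f ∘ punchIn l)) ⟨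
    f l + ∑ F (f ∘ punchIn l)          ≈⟨ +-congˡ (∑-zero _ (λ i → off _ (FinP.punchInᵢ≢i l i))) ⟩
    f l + 0#                           ≈⟨ +-identityʳ (f l) ⟩
    f l                                ∎

  ·-linearˡ : ∀ {n} (u v x : Fin n → Carrier) (t : Carrier) → (λ j → u j + t * v j) · x ≈ u · x + t * (v · x)
  ·-linearˡ u v x t = begin
    (λ j → u j + t * v j) · x                  ≈⟨ ∑-cong (λ j → solve 4 (λ u t v x → (u :+ t :* v) :* x := u :* x :+ t :* (v :* x)) refl (u j) t (v j) (x j)) ⟩
    ∑ F (λ j → u j * x j + t * (v j * x j))    ≈⟨ ∑-+ (λ j → u j * x j) (λ j → t * (v j * x j)) ⟩
    u · x + ∑ F (λ j → t * (v j * x j))        ≈⟨ +-congˡ (∑-*ˡ t (λ j → v j * x j)) ⟩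
    u · x + t * (v · x)                        ∎

  -*- : ∀ a b → - a * - b ≈ a * b
  -*- a b = begin
    - a * - b      ≈⟨ -‿distribˡ-* a (- b) ⟨
    - (a * - b)    ≈⟨ -‿cong (-‿distribʳ-* a b) ⟨
    - (- (a * b))  ≈⟨ -‿involutive (a * b) ⟩
    a * b          ∎

  minorAt : ∀ {n} → Mat (ℕ.suc n) → Fin (ℕ.suc n) → Mat n
  minorAt M j i k = M (suc i) (punchIn j k)

  laplaceTerm : ∀ {n} → Mat (ℕ.suc n) → Fin (ℕ.suc n) → Carrier
  laplaceTerm M j = sign F j * (M zero j * det F (minorAt M j))

  term-zeroᵉ : ∀ s x d → x ≈ 0# → s * (x * d) ≈ 0#
  term-zeroᵉ s x d x≈0 = trans (*-congˡ (trans (*-congʳ x≈0) (zeroˡ d))) (zeroʳ s)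

  term-zeroᵐ : ∀ s x d → d ≈ 0# → s * (x * d) ≈ 0#
  term-zeroᵐ s x d d≈0 = trans (*-congˡ (trans (*-congˡ d≈0) (zeroʳ x))) (zeroʳ s)

  det-cong : ∀ {n} {M M′ : Mat n} → (∀ i j → M i j ≈ M′ i j) → det F M ≈ det F M′
  det-cong {ℕ.zero}  M≈M′ = refl
  det-cong {ℕ.suc n} M≈M′ =
    ∑-cong (λ j → *-congˡ {sign F j} (*-cong (M≈M′ zero j) (det-cong (λ i k → M≈M′ (suc i) (punchIn j k)))))

  det-linear : ∀ {n} (p : Fin n) (X U V : Mat n) (a : Carrier) →
    (∀ k → X p k ≈ U p k + a * V p k) →
    (∀ i → ¬ (i ≡ p) → ∀ k → X i k ≈ U i k) →
    (∀ i → ¬ (i ≡ p) → ∀ k → X i k ≈ V i k) →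
    det F X ≈ det F U + a * det F V
  det-linear {ℕ.suc n} p X U V a rowₚ X≈U X≈V = begin
    det F X                                           ≈⟨ ∑-cong (termwise p rowₚ X≈U X≈V) ⟩
    ∑ F (λ j → laplaceTerm U j + a * laplaceTerm V j)  ≈⟨ ∑-+ (laplaceTerm U) (λ j → a * laplaceTerm V j) ⟩
    det F U + ∑ F (λ j → a * laplaceTerm V j)          ≈⟨ +-congˡ (∑-*ˡ a (laplaceTerm V)) ⟩
    det F U + a * det F V                              ∎
    where
    termwise : ∀ p → (∀ k → X p k ≈ U p k + a * V p k) →
      (∀ i → ¬ (i ≡ p) → ∀ k → X i k ≈ U i k) →
      (∀ i → ¬ (i ≡ p) → ∀ k → X i k ≈ V i k) →
      ∀ j → laplaceTerm X j ≈ laplaceTerm U j + a * laplaceTerm V j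
    -- row 0 is linear; the minors do not involve it
    termwise zero rowₚ X≈U X≈V j = begin
      sign F j * (X zero j * det F (minorAt X j))
        ≈⟨ *-congˡ (*-cong (rowₚ j) (det-cong (λ i k → X≈U (suc i) (λ ()) _))) ⟩
      sign F j * ((U zero j + a * V zero j) * det F (minorAt U j))
        ≈⟨ solve 5 (λ s u a v d → s :* ((u :+ a :* v) :* d) := s :* (u :* d) :+ a :* (s :* (v :* d))) refl _ _ a _ _ ⟩
      laplaceTerm U j + a * (sign F j * (V zero j * det F (minorAt U j)))
        ≈⟨ +-congˡ (*-congˡ (*-congˡ (*-congˡ (det-cong (λ i k → trans (sym (X≈U (suc i) (λ ()) _)) (X≈V (suc i) (λ ()) _)))))) ⟩
      laplaceTerm U j + a * laplaceTerm V j ∎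
    -- row 0 is shared; each minor is linear in row p
    termwise (suc p) rowₚ X≈U X≈V j = begin
      sign F j * (X zero j * det F (minorAt X j))
        ≈⟨ *-congˡ (*-congˡ (det-linear p (minorAt X j) (minorAt U j) (minorAt V j) a (λ k → rowₚ _)
             (λ i i≢p k → X≈U (suc i) (i≢p ∘ FinP.suc-injective) _)
             (λ i i≢p k → X≈V (suc i) (i≢p ∘ FinP.suc-injective) _))) ⟩
      sign F j * (X zero j * (det F (minorAt U j) + a * det F (minorAt V j)))
        ≈⟨ solve 5 (λ s x u a v → s :* (x :* (u :+ a :* v)) := s :* (x :* u) :+ a :* (s :* (x :* v))) refl _ _ _ a _ ⟩
      sign F j * (X zero j * det F (minorAt U j)) + a * (sign F j * (X zero j * det F (minorAt V j)))
        ≈⟨ +-cong (*-congˡ (*-congʳ (X≈U zero (λ ()) j))) (*-congˡ (*-congˡ (*-congʳ (X≈V zero (λ ()) j)))) ⟩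
      laplaceTerm U j + a * laplaceTerm V j ∎

  det-zeroRow : ∀ {n} (M : Mat n) (p : Fin n) → (∀ k → M p k ≈ 0#) → det F M ≈ 0#
  det-zeroRow {ℕ.suc n} M zero    row≈0 = ∑-zero (laplaceTerm M) (λ j → term-zeroᵉ _ _ _ (row≈0 j))
  det-zeroRow {ℕ.suc n} M (suc p) row≈0 =
    ∑-zero (laplaceTerm M) (λ j → term-zeroᵐ _ _ _ (det-zeroRow (minorAt M j) p (λ k → row≈0 _)))

  -- Expanding det along rows 0 and 1 gives a double sum whose (j , l) term uses
  -- column j in row 0, column punchIn j l in row 1, and the columns
  -- punchIn j ∘ punchIn l in the remaining rows (their determinant is Q).
  doubleTerm : ∀ m → (Fin (2 ℕ.+ m) → Carrier) → ((Fin m → Fin (2 ℕ.+ m)) → Carrier) →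
               Fin (2 ℕ.+ m) → Fin (1 ℕ.+ m) → Carrier
  doubleTerm m a Q j l = (sign F j * sign F l) * ((a j * a (punchIn j l)) * Q (punchIn j ∘ punchIn l))

  RespectsPointwise : ∀ {m n} → ((Fin m → Fin n) → Carrier) → Set ℓ
  RespectsPointwise Q = ∀ f g → (∀ k → f k ≡ g k) → Q f ≈ Q g

  -- The terms (0 , l) and (l+1 , 0) cancel in pairs (rows 0 and 1 both being a)
  pair-cancel : ∀ s x y q → (1# * s) * ((x * y) * q) + (- s * 1#) * ((y * x) * q) ≈ 0#
  pair-cancel s x y q = trans (+-congˡ (begin
    (- s * 1#) * ((y * x) * q)     ≈⟨ *-congʳ (-‿distribˡ-* s 1#) ⟨
    - (s * 1#) * ((y * x) * q)     ≈⟨ -‿distribˡ-* _ _ ⟨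
    - ((s * 1#) * ((y * x) * q))   ≈⟨ -‿cong (solve 4 (λ s x y q → (s :* con 1) :* ((y :* x) :* q) := (con 1 :* s) :* ((x :* y) :* q)) refl s x y q) ⟩
    - ((1# * s) * ((x * y) * q))   ∎)) (-‿inverseʳ _)

  -- The terms (j+1 , l+1) of the double sum of size m+1 are the double sum of size m
  -- for the shifted row a ∘ suc and the lifted column choice.
  shiftedTerms : ∀ m a Q → RespectsPointwise Q →
    ∑ F (λ j → ∑ F (λ l → doubleTerm (ℕ.suc m) a Q (suc j) (suc l))) ≈
    ∑ F (λ j → ∑ F (doubleTerm m (a ∘ suc) (Q ∘ Fin.lift 1) j))
  shiftedTerms m a Q Q-resp = ∑-cong (λ j → ∑-cong (λ l →
      *-cong (-*- (sign F j) (sign F l)) (*-congˡ {a (suc j) * a (suc (punchIn j l))} (Q-resp _ _ (punchIns-lift j l)))))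
    where
    punchIns-lift : ∀ (j : Fin (2 ℕ.+ m)) (l : Fin (1 ℕ.+ m)) k →
      punchIn (suc j) (punchIn (suc l) k) ≡ Fin.lift 1 (punchIn j ∘ punchIn l) k
    punchIns-lift j l zero    = Eq.refl
    punchIns-lift j l (suc k) = Eq.refl

  lift-resp : ∀ {m n} {Q : (Fin (ℕ.suc m) → Fin (ℕ.suc n)) → Carrier} → RespectsPointwise Q → RespectsPointwise (Q ∘ Fin.lift 1)
  lift-resp Q-resp f g f≗g = Q-resp _ _ λ { zero → Eq.refl ; (suc k) → Eq.cong suc (f≗g k) }

  -- When rows 0 and 1 agree the double sum vanishes: the terms (0 , l) and
  -- (l+1 , 0) cancel, and the terms (j+1 , l+1) vanish by induction.
  doubleTerms-cancel : ∀ m a Q → RespectsPointwise Q → ∑ F (λ j → ∑ F (doubleTerm m a Q j)) ≈ 0#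
  shiftedTerms-cancel : ∀ m a Q → RespectsPointwise Q →
    ∑ F (λ j → ∑ F (λ l → doubleTerm m a Q (suc j) (suc l))) ≈ 0#

  shiftedTerms-cancel ℕ.zero    a Q Q-resp = ∑-zero {1} _ (λ _ → refl)
  shiftedTerms-cancel (ℕ.suc m) a Q Q-resp =
    trans (shiftedTerms m a Q Q-resp) (doubleTerms-cancel m (a ∘ suc) (Q ∘ Fin.lift 1) (lift-resp Q-resp))

  doubleTerms-cancel m a Q Q-resp = begin
    ∑ F (T zero) + ∑ F (λ j → T (suc j) zero + shifted j)
      ≈⟨ +-congˡ (∑-+ (λ j → T (suc j) zero) shifted) ⟩
    ∑ F (T zero) + (∑ F (λ j → T (suc j) zero) + ∑ F shifted)
      ≈⟨ +-assoc _ _ _ ⟨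
    (∑ F (T zero) + ∑ F (λ j → T (suc j) zero)) + ∑ F shifted
      ≈⟨ +-cong (trans (sym (∑-+ (T zero) (λ j → T (suc j) zero)))
                   (∑-zero (λ l → T zero l + T (suc l) zero) (λ l → pair-cancel _ _ _ _)))
                (shiftedTerms-cancel m a Q Q-resp) ⟩
    0# + 0#
      ≈⟨ +-identityʳ 0# ⟩
    0# ∎
    where
    T = doubleTerm m a Q
    shifted : Fin (1 ℕ.+ m) → Carrier
    shifted j = ∑ F (λ l → T (suc j) (suc l))

  det-rows01 : ∀ {m} (M : Mat (2 ℕ.+ m)) → (∀ k → M zero k ≈ M (suc zero) k) → det F M ≈ 0#
  det-rows01 {m} M row₀≈row₁ = trans (∑-cong expand) (doubleTerms-cancel m (M zero) Q Q-resp)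
    where
    Q : (Fin m → Fin (2 ℕ.+ m)) → Carrier
    Q f = det F (λ i k → M (suc (suc i)) (f k))
    Q-resp : RespectsPointwise Q
    Q-resp f g f≗g = det-cong (λ i k → reflexive (Eq.cong (M (suc (suc i))) (f≗g k)))
    expand : ∀ j → laplaceTerm M j ≈ ∑ F (doubleTerm m (M zero) Q j)
    expand j = begin
      sign F j * (M zero j * ∑ F (laplaceTerm (minorAt M j)))
        ≈⟨ *-congˡ (∑-*ˡ (M zero j) (laplaceTerm (minorAt M j))) ⟨
      sign F j * ∑ F (λ l → M zero j * laplaceTerm (minorAt M j) l)
        ≈⟨ ∑-*ˡ (sign F j) (λ l → M zero j * laplaceTerm (minorAt M j) l) ⟨
      ∑ F (λ l → sign F j * (M zero j * laplaceTerm (minorAt M j) l))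
        ≈⟨ ∑-cong (λ l → trans (solve 5 (λ s x t y q → s :* (x :* (t :* (y :* q))) := (s :* t) :* ((x :* y) :* q)) refl
                                 (sign F j) (M zero j) (sign F l) (M (suc zero) (punchIn j l)) (Q (punchIn j ∘ punchIn l)))
                               (*-congˡ (*-congʳ (*-congˡ (sym (row₀≈row₁ _)))))) ⟩
      ∑ F (doubleTerm m (M zero) Q j) ∎

  det-additive : ∀ {n} (p : Fin n) (X U V : Mat n) →
    (∀ k → X p k ≈ U p k + V p k) →
    (∀ i → ¬ (i ≡ p) → ∀ k → X i k ≈ U i k) →
    (∀ i → ¬ (i ≡ p) → ∀ k → X i k ≈ V i k) →
    det F X ≈ det F U + det F V
  det-additive p X U V rowₚ X≈U X≈V =
    trans (det-linear p X U V 1# (λ k → trans (rowₚ k) (+-congˡ (sym (*-identityˡ _)))) X≈U X≈V)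
          (+-congˡ (*-identityˡ _))

  withTop : ∀ {m} → (u v : Fin (2 ℕ.+ m) → Carrier) → Mat (2 ℕ.+ m) → Mat (2 ℕ.+ m)
  withTop u v M zero          = u
  withTop u v M (suc zero)    = v
  withTop u v M (suc (suc i)) = M (suc (suc i))

  withTop-off₀ : ∀ {m} u u′ v (M : Mat (2 ℕ.+ m)) i → ¬ (i ≡ zero) → ∀ k → withTop u v M i k ≈ withTop u′ v M i k
  withTop-off₀ u u′ v M zero          i≢0 k = contradiction Eq.refl i≢0
  withTop-off₀ u u′ v M (suc zero)    i≢0 k = refl
  withTop-off₀ u u′ v M (suc (suc i)) i≢0 k = refl

  withTop-off₁ : ∀ {m} u v v′ (M : Mat (2 ℕ.+ m)) i → ¬ (i ≡ suc zero) → ∀ k → withTop u v M i k ≈ withTop u v′ M i k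
  withTop-off₁ u v v′ M zero          i≢1 k = refl
  withTop-off₁ u v v′ M (suc zero)    i≢1 k = contradiction Eq.refl i≢1
  withTop-off₁ u v v′ M (suc (suc i)) i≢1 k = refl

  withTop-self : ∀ {m} (M : Mat (2 ℕ.+ m)) i k → withTop (M zero) (M (suc zero)) M i k ≈ M i k
  withTop-self M zero          k = refl
  withTop-self M (suc zero)    k = refl
  withTop-self M (suc (suc i)) k = refl

  -- Swapping rows 0 and 1 negates det: expand det (u+v , u+v) = 0 by additivity.
  det-swap01 : ∀ {m} (M : Mat (2 ℕ.+ m)) → det F (withTop (M (suc zero)) (M zero) M) ≈ - det F M
  det-swap01 M = +-inverseʳ-unique (det F M) (D v u) (begin
    det F M + D v u                     ≈⟨ +-congʳ (det-cong (withTop-self M)) ⟨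
    D u v + D v u                       ≈⟨ +-cong (trans (+-congʳ (det-rows01 (withTop u u M) (λ _ → refl))) (+-identityˡ _))
                                                   (trans (+-congˡ (det-rows01 (withTop v v M) (λ _ → refl))) (+-identityʳ _)) ⟨
    (D u u + D u v) + (D v u + D v v)   ≈⟨ +-cong (additive₁ u) (additive₁ v) ⟨
    D u w + D v w                       ≈⟨ det-additive zero (withTop w w M) (withTop u w M) (withTop v w M) (λ _ → refl) (withTop-off₀ w u w M) (withTop-off₀ w v w M) ⟨
    D w w                               ≈⟨ det-rows01 (withTop w w M) (λ _ → refl) ⟩
    0#                                  ∎)
    where
    u = M zero
    v = M (suc zero)
    w = λ k → u k + v k
    D = λ a b → det F (withTop a b M)
    additive₁ : ∀ a → D a w ≈ D a u + D a v
    additive₁ a = det-additive (suc zero) (withTop a w M) (withTop a u M) (withTop a v M) (λ _ → refl) (withTop-off₁ a w u M) (withTop-off₁ a w v M)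

  -- Equal rows 0 and q+1 force det 0: for q = 0 this is det-rows01; otherwise
  -- swap rows 0 and 1, after which every minor of the expansion has two equal rows.
  det-equalRow0 : ∀ {m} (M : Mat (ℕ.suc m)) (q : Fin m) → (∀ k → M zero k ≈ M (suc q) k) → det F M ≈ 0#
  det-equalRow0 {ℕ.suc m} M zero    same = det-rows01 M same
  det-equalRow0 {ℕ.suc m} M (suc q) same = begin
    det F M        ≈⟨ -‿involutive _ ⟨
    - (- det F M)  ≈⟨ -‿cong (det-swap01 M) ⟨
    - det F M′     ≈⟨ -‿cong (∑-zero (laplaceTerm M′) λ j →
                        term-zeroᵐ _ _ _ (det-equalRow0 (minorAt M′ j) q (λ k → same _))) ⟩
    - 0#           ≈⟨ -0#≈0# ⟩
    0#             ∎
    where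
    M′ = withTop (M (suc zero)) (M zero) M

  det-equalRows : ∀ {n} (M : Mat n) (p q : Fin n) → ¬ (p ≡ q) → (∀ k → M p k ≈ M q k) → det F M ≈ 0#
  det-equalRows M zero    zero    p≢q same = contradiction Eq.refl p≢q
  det-equalRows M zero    (suc q) p≢q same = det-equalRow0 M q same
  det-equalRows M (suc p) zero    p≢q same = det-equalRow0 M p (λ k → sym (same k))
  det-equalRows M (suc p) (suc q) p≢q same = ∑-zero (laplaceTerm M) λ j →
    term-zeroᵐ _ _ _ (det-equalRows (minorAt M j) p q (p≢q ∘ Eq.cong suc) (λ k → same _))

  withRow : ∀ {n} → Mat n → Fin n → (Fin n → Carrier) → Mat n
  withRow M p v = updateAt M p (λ _ → v)

  withRow-at : ∀ {n} (M : Mat n) p v k → withRow M p v p k ≈ v k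
  withRow-at M p v k = reflexive (Eq.cong-app (updateAt-updates p M) k)

  withRow-off : ∀ {n} (M : Mat n) p v i → ¬ (i ≡ p) → ∀ k → withRow M p v i k ≈ M i k
  withRow-off M p v i i≢p k = reflexive (Eq.cong-app (updateAt-minimal i p M i≢p) k)

  det-rowAdd : ∀ {n} (p q : Fin n) → ¬ (p ≡ q) → (t : Carrier) (X M : Mat n) →
    (∀ k → X p k ≈ M p k + t * M q k) → (∀ i → ¬ (i ≡ p) → ∀ k → X i k ≈ M i k) → det F X ≈ det F M
  det-rowAdd p q p≢q t X M rowₚ X≈M = begin
    det F X            ≈⟨ det-linear p X M V t (λ k → trans (rowₚ k) (+-congˡ (*-congˡ (sym (withRow-at M p (M q) k)))))
                            X≈M (λ i i≢p k → trans (X≈M i i≢p k) (sym (withRow-off M p (M q) i i≢p k))) ⟩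
    det F M + t * det F V ≈⟨ +-congˡ (*-congˡ (det-equalRows V p q p≢q λ k →
                               trans (withRow-at M p (M q) k) (sym (withRow-off M p (M q) q (p≢q ∘ Eq.sym) k)))) ⟩
    det F M + t * 0#   ≈⟨ +-congˡ (zeroʳ t) ⟩
    det F M + 0#       ≈⟨ +-identityʳ _ ⟩
    det F M            ∎
    where
    V = withRow M p (M q)

  det-zeroColumn0 : ∀ {n} (M : Mat (ℕ.suc n)) → (∀ i → M i zero ≈ 0#) → det F M ≈ 0#
  det-zeroColumn0 {n} M col≈0 = ∑-zero (laplaceTerm M) (term n M col≈0)
    where
    term : ∀ n (M : Mat (ℕ.suc n)) → (∀ i → M i zero ≈ 0#) → ∀ j → laplaceTerm M j ≈ 0#
    term n         M col≈0 zero    = term-zeroᵉ _ _ _ (col≈0 zero)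
    term (ℕ.suc n) M col≈0 (suc j) = term-zeroᵐ _ _ _ (det-zeroColumn0 (minorAt M (suc j)) (λ i → col≈0 (suc i)))

  det-pivot : ∀ {n} (M : Mat (ℕ.suc n)) → (∀ i → M (suc i) zero ≈ 0#) →
    det F M ≈ M zero zero * det F (λ i k → M (suc i) (suc k))
  det-pivot {n} M col≈0 = begin
    laplaceTerm M zero + ∑ F (λ j → laplaceTerm M (suc j))  ≈⟨ +-congˡ (∑-zero _ (otherTerms n M col≈0)) ⟩
    1# * (M zero zero * det F (λ i k → M (suc i) (suc k))) + 0#  ≈⟨ trans (+-identityʳ _) (*-identityˡ _) ⟩
    M zero zero * det F (λ i k → M (suc i) (suc k))           ∎
    where
    otherTerms : ∀ n (M : Mat (ℕ.suc n)) → (∀ i → M (suc i) zero ≈ 0#) → ∀ j → laplaceTerm M (suc j) ≈ 0#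
    otherTerms (ℕ.suc n) M col≈0 j = term-zeroᵐ _ _ _ (det-zeroColumn0 (minorAt M (suc j)) col≈0)

  det-combination : ∀ {n m} (M : Mat n) (p : Fin n) (y : Fin m → Carrier) (v : Fin m → Fin n → Carrier) →
    det F (withRow M p (λ k → ∑ F (λ l → y l * v l k))) ≈ ∑ F (λ l → y l * det F (withRow M p (v l)))
  det-combination {m = ℕ.zero}  M p y v = det-zeroRow _ p (withRow-at M p _)
  det-combination {m = ℕ.suc m} M p y v = begin
    det F X                                   ≈⟨ det-linear p X U V (y zero) rowₚ
                                                   (λ i i≢p k → trans (withRow-off M p _ i i≢p k) (sym (withRow-off M p _ i i≢p k)))
                                                   (λ i i≢p k → trans (withRow-off M p _ i i≢p k) (sym (withRow-off M p _ i i≢p k))) ⟩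
    det F U + y zero * det F V                ≈⟨ +-congʳ (det-combination M p (y ∘ suc) (v ∘ suc)) ⟩
    ∑ F (λ l → y (suc l) * det F (withRow M p (v (suc l)))) + y zero * det F V ≈⟨ +-comm _ _ ⟩
    y zero * det F V + ∑ F (λ l → y (suc l) * det F (withRow M p (v (suc l)))) ∎
    where
    X = withRow M p (λ k → ∑ F (λ l → y l * v l k))
    U = withRow M p (λ k → ∑ F (λ l → y (suc l) * v (suc l) k))
    V = withRow M p (v zero)
    rowₚ : ∀ k → X p k ≈ U p k + y zero * V p k
    rowₚ k = begin
      X p k                                                       ≈⟨ withRow-at M p _ k ⟩
      y zero * v zero k + ∑ F (λ l → y (suc l) * v (suc l) k)      ≈⟨ +-comm _ _ ⟩
      ∑ F (λ l → y (suc l) * v (suc l) k) + y zero * v zero k      ≈⟨ +-cong (withRow-at M p _ k) (*-congˡ (withRow-at M p _ k)) ⟨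
      U p k + y zero * V p k                                      ∎

  -- If det M ≉ 0 the rows of M are linearly independent: replacing row i by the
  -- combination ∑ yₗ Mₗ gives yᵢ · det M (all other terms have two equal rows).
  det≉0⇒rowsIndependent : ∀ {n} (M : Mat n) → ¬ (det F M ≈ 0#) → (y : Fin n → Carrier) →
    (∀ j → ∑ F (λ i → y i * M i j) ≈ 0#) → ∀ i → y i ≈ 0#
  det≉0⇒rowsIndependent M det≉0 y yM≈0 i = cancelNonzero (det F M) (y i) det≉0 (trans (*-comm _ _) (begin
    y i * det F M                                     ≈⟨ *-congˡ (det-cong (λ r k → sym (withRow-self r k))) ⟩
    y i * det F (withRow M i (M i))                    ≈⟨ ∑-single (λ l → y l * det F (withRow M i (M l))) i off ⟨
    ∑ F (λ l → y l * det F (withRow M i (M l)))        ≈⟨ det-combination M i y M ⟨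
    det F (withRow M i (λ k → ∑ F (λ l → y l * M l k))) ≈⟨ det-zeroRow _ i (λ k → trans (withRow-at M i _ k) (yM≈0 k)) ⟩
    0#                                                ∎))
    where
    withRow-self : ∀ r k → withRow M i (M i) r k ≈ M r k
    withRow-self r k with r Fin.≟ i
    ... | yes Eq.refl = withRow-at M i (M i) k
    ... | no  r≢i     = withRow-off M i (M i) r r≢i k
    off : ∀ l → ¬ (l ≡ i) → y l * det F (withRow M i (M l)) ≈ 0#
    off l l≢i = trans (*-congˡ (det-equalRows _ i l (l≢i ∘ Eq.sym) λ k →
                  trans (withRow-at M i (M l) k) (sym (withRow-off M i (M l) l l≢i k)))) (zeroʳ _)

  InKernel : ∀ {n} → Mat n → (Fin n → Carrier) → Set ℓ
  InKernel M x = ∀ i → M i · x ≈ 0#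

  TrivialKernel : ∀ {n} → Mat n → Set (c ⊔ ℓ)
  TrivialKernel M = ∀ x → InKernel M x → ¬ ¬ (∀ j → x j ≈ 0#)

  -- If every row of M is a row of X plus a multiple of a row of X, then
  -- Ker X ⊆ Ker M; so row operations preserve a trivial kernel.
  trivialKernel-rowOps : ∀ {n} (M X : Mat n) →
    (∀ i → Σ (Fin n) λ j → Σ Carrier λ t → ∀ k → M i k ≈ X i k + t * X j k) →
    TrivialKernel M → TrivialKernel X
  trivialKernel-rowOps M X rowsOfM trivial x Xx≈0 = trivial x Mx≈0
    where
    Mx≈0 : InKernel M x
    Mx≈0 i with rowsOfM i
    ... | j , t , rowᵢ = begin
      M i · x                          ≈⟨ ∑-cong (λ k → *-congʳ (rowᵢ k)) ⟩
      (λ k → X i k + t * X j k) · x    ≈⟨ ·-linearˡ (X i) (X j) x t ⟩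
      X i · x + t * (X j · x)          ≈⟨ +-cong (Xx≈0 i) (trans (*-congˡ (Xx≈0 j)) (zeroʳ t)) ⟩
      0# + 0#                          ≈⟨ +-identityʳ 0# ⟩
      0#                               ∎

  plusZeroTimes : ∀ a b → a ≈ a + 0# * b
  plusZeroTimes a b = sym (trans (+-congˡ (zeroˡ b)) (+-identityʳ a))

  addToRow0 : ∀ {m} → Mat (ℕ.suc m) → Fin m → Carrier → Mat (ℕ.suc m)
  addToRow0 M i t zero    k = M zero k + t * M (suc i) k
  addToRow0 M i t (suc r) k = M (suc r) k

  makePivot : ∀ {m} (M : Mat (ℕ.suc m)) (i : Fin (ℕ.suc m)) → ¬ (M i zero ≈ 0#) →
    Σ (Mat (ℕ.suc m)) λ M′ → ¬ (M′ zero zero ≈ 0#) × det F M′ ≈ det F M × (TrivialKernel M → TrivialKernel M′)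
  makePivot M zero    M₀₀≉0 = M , M₀₀≉0 , refl , (λ trivial → trivial)
  makePivot M (suc i) Mᵢ₀≉0 with inverse (M (suc i) zero) Mᵢ₀≉0
  ... | w , Mᵢ₀w≈1 = addToRow0 M i t , pivot≉0 , det-rowAdd zero (suc i) (λ ()) t (addToRow0 M i t) M (λ k → refl) unchanged
                   , trivialKernel-rowOps M (addToRow0 M i t) rowsOfM
    where
    t = (1# + - M zero zero) * w
    -- the new pivot is M₀₀ + (1 - M₀₀) = 1
    pivot≉0 : ¬ (M zero zero + t * M (suc i) zero ≈ 0#)
    pivot≉0 pivot≈0 = 1≉0 (trans (sym (begin
      M zero zero + t * M (suc i) zero                 ≈⟨ +-congˡ (solve 3 (λ u w b → (u :* w) :* b := u :* (b :* w)) refl _ w _) ⟩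
      M zero zero + (1# + - M zero zero) * (M (suc i) zero * w) ≈⟨ +-congˡ (trans (*-congˡ Mᵢ₀w≈1) (*-identityʳ _)) ⟩
      M zero zero + (1# + - M zero zero)               ≈⟨ solve 3 (λ a o n → a :+ (o :+ n) := o :+ (a :+ n)) refl _ 1# _ ⟩
      1# + (M zero zero + - M zero zero)               ≈⟨ +-congˡ (-‿inverseʳ _) ⟩
      1# + 0#                                          ≈⟨ +-identityʳ 1# ⟩
      1#                                               ∎)) pivot≈0)
    unchanged : ∀ r → ¬ (r ≡ zero) → ∀ k → addToRow0 M i t r k ≈ M r k
    unchanged zero    r≢0 k = contradiction Eq.refl r≢0
    unchanged (suc r) r≢0 k = refl
    rowsOfM : ∀ r → Σ (Fin _) λ j → Σ Carrier λ s → ∀ k → M r k ≈ addToRow0 M i t r k + s * addToRow0 M i t j k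
    rowsOfM zero    = suc i , - t , λ k → sym (begin
      (M zero k + t * M (suc i) k) + - t * M (suc i) k  ≈⟨ +-assoc _ _ _ ⟩
      M zero k + (t * M (suc i) k + - t * M (suc i) k)  ≈⟨ +-congˡ (trans (sym (distribʳ _ t (- t))) (trans (*-congʳ (-‿inverseʳ t)) (zeroˡ _))) ⟩
      M zero k + 0#                                     ≈⟨ +-identityʳ _ ⟩
      M zero k                                          ∎)
    rowsOfM (suc r) = suc r , 0# , λ k → plusZeroTimes _ _

  addMultiplesOfRow0 : ∀ {m} → Mat (ℕ.suc m) → (Fin m → Carrier) → Mat (ℕ.suc m)
  addMultiplesOfRow0 M d zero    k = M zero k
  addMultiplesOfRow0 M d (suc r) k = M (suc r) k + d r * M zero k

  -- These row additions do not change det; perform them one row at a time,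
  -- following a list of rows that contains every row with d r ≉ 0.
  det-addMultiplesOfRow0 : ∀ {m} (M : Mat (ℕ.suc m)) (d : Fin m → Carrier) →
    det F (addMultiplesOfRow0 M d) ≈ det F M
  det-addMultiplesOfRow0 {m} M d = viaRows (allFin m) d (λ r r∉ → contradiction (∈-allFin r) r∉)
    where
    viaRows : ∀ (rs : List (Fin m)) d → (∀ r → r ∉ˡ rs → d r ≈ 0#) → det F (addMultiplesOfRow0 M d) ≈ det F M
    viaRows []       d d≈0 = det-cong {M = addMultiplesOfRow0 M d} {M′ = M} λ
      { zero    k → refl
      ; (suc r) k → trans (+-congˡ (trans (*-congʳ (d≈0 r λ ())) (zeroˡ _))) (+-identityʳ _) }
    viaRows (r ∷ rs) d d≈0 =
      trans (det-rowAdd (suc r) zero (λ ()) (d r) (addMultiplesOfRow0 M d) (addMultiplesOfRow0 M d′) rowᵣ others)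
            (viaRows rs d′ d′≈0)
      where
      d′ = updateAt d r (λ _ → 0#)
      d′ᵣ≈0 : d′ r ≈ 0#
      d′ᵣ≈0 = reflexive (updateAt-updates r d)
      d′-off : ∀ s → ¬ (s ≡ r) → d′ s ≈ d s
      d′-off s s≢r = reflexive (updateAt-minimal s r d s≢r)
      d′≈0 : ∀ s → s ∉ˡ rs → d′ s ≈ 0#
      d′≈0 s s∉rs with s Fin.≟ r
      ... | yes Eq.refl = d′ᵣ≈0
      ... | no  s≢r     = trans (d′-off s s≢r) (d≈0 s λ { (Any.here s≡r) → s≢r s≡r ; (Any.there s∈rs) → s∉rs s∈rs })
      rowᵣ : ∀ k → M (suc r) k + d r * M zero k ≈ (M (suc r) k + d′ r * M zero k) + d r * M zero k
      rowᵣ k = +-congʳ (sym (trans (+-congˡ (trans (*-congʳ d′ᵣ≈0) (zeroˡ _))) (+-identityʳ _)))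
      others : ∀ i → ¬ (i ≡ suc r) → ∀ k → addMultiplesOfRow0 M d i k ≈ addMultiplesOfRow0 M d′ i k
      others zero    i≢r k = refl
      others (suc s) i≢r k = +-congˡ (*-congʳ (sym (d′-off s (i≢r ∘ Eq.cong suc))))

  -- One step of Gaussian elimination: with p⁻¹ the inverse of the pivot M₀₀,
  -- subtracting M_{r+1,0} p⁻¹ times row 0 from row r+1 clears the first column;
  -- what remains below and to the right is the block schur M p⁻¹.
  eliminated : ∀ {m} → Mat (ℕ.suc m) → Carrier → Mat (ℕ.suc m)
  eliminated M p⁻¹ = addMultiplesOfRow0 M (λ r → - (M (suc r) zero * p⁻¹))

  schur : ∀ {m} → Mat (ℕ.suc m) → Carrier → Mat m
  schur M p⁻¹ r k = eliminated M p⁻¹ (suc r) (suc k)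

  module _ {m} (M : Mat (ℕ.suc m)) (p⁻¹ : Carrier) (pp⁻¹≈1 : M zero zero * p⁻¹ ≈ 1#) where

    eliminated-column0 : ∀ r → eliminated M p⁻¹ (suc r) zero ≈ 0#
    eliminated-column0 r = begin
      M (suc r) zero + - (M (suc r) zero * p⁻¹) * M zero zero  ≈⟨ +-congˡ (sym (-‿distribˡ-* _ _)) ⟩
      M (suc r) zero + - ((M (suc r) zero * p⁻¹) * M zero zero) ≈⟨ +-congˡ (-‿cong (trans (*-assoc _ _ _) (trans (*-congˡ (trans (*-comm _ _) pp⁻¹≈1)) (*-identityʳ _)))) ⟩
      M (suc r) zero + - M (suc r) zero                        ≈⟨ -‿inverseʳ _ ⟩
      0#                                                       ∎

    det-schur : det F M ≈ M zero zero * det F (schur M p⁻¹)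
    det-schur = trans (sym (det-addMultiplesOfRow0 M _)) (det-pivot (eliminated M p⁻¹) eliminated-column0)

    -- A kernel vector z of the block extends, by x₀ = -p⁻¹ (M₀ · (0 , z)), to a kernel
    -- vector of the eliminated matrix; so the block inherits a trivial kernel.
    trivialKernel-schur : TrivialKernel M → TrivialKernel (schur M p⁻¹)
    trivialKernel-schur trivialM z Nz≈0 z≉0 = trivialE x Ex≈0 (λ x≈0 → z≉0 (x≈0 ∘ suc))
      where
      E = eliminated M p⁻¹
      trivialE : TrivialKernel E
      trivialE = trivialKernel-rowOps M E rowsOfM trivialM
        where
        rowsOfM : ∀ i → Σ (Fin _) λ j → Σ Carrier λ t → ∀ k → M i k ≈ E i k + t * E j k
        rowsOfM zero    = zero , 0# , λ k → plusZeroTimes _ _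
        rowsOfM (suc r) = zero , - d , λ k → sym (begin
          (M (suc r) k + d * M zero k) + - d * M zero k  ≈⟨ +-assoc _ _ _ ⟩
          M (suc r) k + (d * M zero k + - d * M zero k)  ≈⟨ +-congˡ (trans (sym (distribʳ _ d (- d))) (trans (*-congʳ (-‿inverseʳ d)) (zeroˡ _))) ⟩
          M (suc r) k + 0#                               ≈⟨ +-identityʳ _ ⟩
          M (suc r) k                                    ∎)
          where d = - (M (suc r) zero * p⁻¹)
      s = (λ k → M zero (suc k)) · z
      x : Fin (ℕ.suc m) → Carrier
      x zero    = - (p⁻¹ * s)
      x (suc k) = z k
      Ex≈0 : InKernel E x
      Ex≈0 zero    = begin
        M zero zero * - (p⁻¹ * s) + s   ≈⟨ +-congʳ (sym (-‿distribʳ-* _ _)) ⟩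
        - (M zero zero * (p⁻¹ * s)) + s ≈⟨ +-congʳ (-‿cong (trans (sym (*-assoc _ _ _)) (trans (*-congʳ pp⁻¹≈1) (*-identityˡ s)))) ⟩
        - s + s                         ≈⟨ -‿inverseˡ s ⟩
        0#                              ∎
      Ex≈0 (suc r) = begin
        E (suc r) zero * x zero + schur M p⁻¹ r · z ≈⟨ +-cong (trans (*-congʳ (eliminated-column0 r)) (zeroˡ _)) (Nz≈0 r) ⟩
        0# + 0#                                     ≈⟨ +-identityʳ 0# ⟩
        0#                                          ∎

  ¬¬-∀ : ∀ {a n} (P : Fin n → Set a) → (∀ i → ¬ ¬ P i) → ¬ ¬ (∀ i → P i)
  ¬¬-∀ {n = ℕ.zero}  P ¬¬P ¬∀P = ¬∀P (λ ())
  ¬¬-∀ {n = ℕ.suc n} P ¬¬P ¬∀P = ¬¬P zero λ P₀ →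
    ¬¬-∀ (P ∘ suc) (¬¬P ∘ suc) λ Pₛ → ¬∀P λ { zero → P₀ ; (suc i) → Pₛ i }

  -- A matrix with trivial kernel has nonzero determinant, by Gaussian elimination:
  -- the first column is not zero (else the first unit vector is in the kernel),
  -- so a pivot can be made and det M = pivot · det (schur block).
  trivialKernel⇒det≉0 : ∀ {n} (M : Mat n) → TrivialKernel M → ¬ (det F M ≈ 0#)
  trivialKernel⇒det≉0 {ℕ.zero}  M trivial det≈0 = 1≉0 det≈0
  trivialKernel⇒det≉0 {ℕ.suc m} M trivial det≈0 =
    ¬¬-∀ (λ i → M i zero ≈ 0#) noPivotAt λ column₀≈0 →
      trivial e₀ (e₀-inKernel column₀≈0) λ e₀≈0 → 1≉0 (e₀≈0 zero)
    where
    e₀ : Fin (ℕ.suc m) → Carrier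
    e₀ zero    = 1#
    e₀ (suc k) = 0#
    e₀-inKernel : (∀ i → M i zero ≈ 0#) → InKernel M e₀
    e₀-inKernel column₀≈0 i = trans (+-cong (trans (*-identityʳ _) (column₀≈0 i)) (∑-zero (λ k → M i (suc k) * e₀ (suc k)) (λ k → zeroʳ _))) (+-identityʳ 0#)
    noPivotAt : ∀ i → ¬ ¬ (M i zero ≈ 0#)
    noPivotAt i Mᵢ₀≉0 with makePivot M i Mᵢ₀≉0
    ... | M′ , p≉0 , det≈ , keepTrivial with inverse (M′ zero zero) p≉0
    ...   | p⁻¹ , pp⁻¹≈1 =
      trivialKernel⇒det≉0 (schur M′ p⁻¹) (trivialKernel-schur M′ p⁻¹ pp⁻¹≈1 (keepTrivial trivial))
        (cancelNonzero _ _ p≉0 (trans (sym (det-schur M′ p⁻¹ pp⁻¹≈1)) (trans det≈ det≈0)))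

  enum-onto : ∀ {n} (γ : Subset n) m → m ∈ γ → Σ (Fin ∣ γ ∣) λ i → enum F γ i ≡ m
  enum-onto (inside  ∷ γ) zero    here       = zero , Eq.refl
  enum-onto (inside  ∷ γ) (suc m) (there m∈γ) with enum-onto γ m m∈γ
  ... | i , eᵢ≡m = suc i , Eq.cong suc eᵢ≡m
  enum-onto (outside ∷ γ) (suc m) (there m∈γ) with enum-onto γ m m∈γ
  ... | i , eᵢ≡m = i , Eq.cong suc eᵢ≡m

  ·-onSupport : ∀ {n} (γ : Subset n) (u x : Fin n → Carrier) → (∀ m → m ∉ γ → x m ≈ 0#) →
    u · x ≈ (u ∘ enum F γ) · (x ∘ enum F γ)
  ·-onSupport []            u x x≈0 = refl
  ·-onSupport (inside  ∷ γ) u x x≈0 =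
    +-congˡ (·-onSupport γ (u ∘ suc) (x ∘ suc) (λ m m∉γ → x≈0 (suc m) (m∉γ ∘ drop-there)))
  ·-onSupport (outside ∷ γ) u x x≈0 = begin
    u zero * x zero + (u ∘ suc) · (x ∘ suc)  ≈⟨ +-cong (trans (*-congˡ (x≈0 zero λ ())) (zeroʳ _))
                                                  (·-onSupport γ (u ∘ suc) (x ∘ suc) (λ m m∉γ → x≈0 (suc m) (m∉γ ∘ drop-there))) ⟩
    0# + (u ∘ suc ∘ enum F γ) · (x ∘ suc ∘ enum F γ) ≈⟨ +-identityˡ _ ⟩
    (u ∘ suc ∘ enum F γ) · (x ∘ suc ∘ enum F γ)      ∎

  extendByZero : ∀ {n} (γ : Subset n) → (Fin ∣ γ ∣ → Carrier) → Fin n → Carrier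
  extendByZero (inside  ∷ γ) y zero    = y zero
  extendByZero (inside  ∷ γ) y (suc m) = extendByZero γ (y ∘ suc) m
  extendByZero (outside ∷ γ) y zero    = 0#
  extendByZero (outside ∷ γ) y (suc m) = extendByZero γ y m

  extendByZero-enum : ∀ {n} (γ : Subset n) y i → extendByZero γ y (enum F γ i) ≡ y i
  extendByZero-enum (inside  ∷ γ) y zero    = Eq.refl
  extendByZero-enum (inside  ∷ γ) y (suc i) = extendByZero-enum γ (y ∘ suc) i
  extendByZero-enum (outside ∷ γ) y i       = extendByZero-enum γ y i

  extendByZero-off : ∀ {n} (γ : Subset n) y m → m ∉ γ → extendByZero γ y m ≈ 0#
  extendByZero-off (inside  ∷ γ) y zero    m∉γ = contradiction here m∉γ
  extendByZero-off (inside  ∷ γ) y (suc m) m∉γ = extendByZero-off γ (y ∘ suc) m (m∉γ ∘ there)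
  extendByZero-off (outside ∷ γ) y zero    m∉γ = refl
  extendByZero-off (outside ∷ γ) y (suc m) m∉γ = extendByZero-off γ y m (m∉γ ∘ there)

  ∣γ∣<∣γ∪l∣ : ∀ {n} (γ : Subset n) l → l ∉ γ → ∣ γ ∣ < ∣ γ ∪ ⁅ l ⁆ ∣
  ∣γ∣<∣γ∪l∣ γ l l∉γ = p⊂q⇒∣p∣<∣q∣ (p⊆p∪q ⁅ l ⁆ , l , x∈p∪q⁺ (inj₂ (x∈⁅x⁆ l)) , l∉γ)

  ∉γ∪l : ∀ {n} (γ : Subset n) l m → m ∉ γ → ¬ (m ≡ l) → m ∉ γ ∪ ⁅ l ⁆
  ∉γ∪l γ l m m∉γ m≢l m∈ with x∈p∪q⁻ γ ⁅ l ⁆ m∈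
  ... | inj₁ m∈γ = m∉γ m∈γ
  ... | inj₂ m∈l = m≢l (x∈⁅y⁆⇒x≡y l m∈l)

  initialSegment : ∀ {n} k → k ≤ n → Subset n
  initialSegment ℕ.zero    _             = ⊥
  initialSegment (ℕ.suc k) (ℕ.s≤s k≤n) = inside ∷ initialSegment k k≤n

  ∣initialSegment∣ : ∀ {n} k (k≤n : k ≤ n) → ∣ initialSegment k k≤n ∣ ≡ k
  ∣initialSegment∣ {n} ℕ.zero    _           = ∣⊥∣≡0 n
  ∣initialSegment∣     (ℕ.suc k) (ℕ.s≤s k≤n) = Eq.cong ℕ.suc (∣initialSegment∣ k k≤n)

  principal-quasiPrincipal : ∀ {n} k (γ : Subset n) → ∣ γ ∣ ≡ k → QuasiPrincipal F k γ γ
  principal-quasiPrincipal k γ ∣γ∣≡k =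
    ∣γ∣≡k , ∣γ∣≡k , Eq.subst (k ℕ.∸ 1 ≤_) (Eq.sym ∣γ∩γ∣≡k) (ℕP.m∸n≤m k 1) , ℕP.≤-reflexive ∣γ∩γ∣≡k
    where
    ∣γ∩γ∣≡k : ∣ γ ∩ γ ∣ ≡ k
    ∣γ∩γ∣≡k = Eq.trans (Eq.cong ∣_∣ (∩-idem γ)) ∣γ∣≡k

  ·-symmetric : ∀ {n} (B : Mat n) → IsSymmetric F B → ∀ c x → c · (λ p → B p · x) ≈ x · (λ m → B m · c)
  ·-symmetric B symmetric c x = begin
    ∑ F (λ p → c p * ∑ F (λ m → B p m * x m))        ≈⟨ ∑-cong (λ p → sym (∑-*ˡ (c p) (λ m → B p m * x m))) ⟩
    ∑ F (λ p → ∑ F (λ m → c p * (B p m * x m)))      ≈⟨ ∑-cong (λ p → ∑-cong (λ m → reorder p m)) ⟩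
    ∑ F (λ p → ∑ F (λ m → x m * (B m p * c p)))      ≈⟨ ∑-swap (λ p m → x m * (B m p * c p)) ⟩
    ∑ F (λ m → ∑ F (λ p → x m * (B m p * c p)))      ≈⟨ ∑-cong (λ m → ∑-*ˡ (x m) (λ p → B m p * c p)) ⟩
    ∑ F (λ m → x m * ∑ F (λ p → B m p * c p))        ∎
    where
    reorder : ∀ p m → c p * (B p m * x m) ≈ x m * (B m p * c p)
    reorder p m = trans (*-congˡ (*-congʳ (symmetric p m)))
                        (solve 3 (λ c b x → c :* (b :* x) := x :* (b :* c)) refl (c p) (B m p) (x m))

  module Symmetric {n} (B : Mat n) (symmetric : IsSymmetric F B) where

    principal : (γ : Subset n) → Mat ∣ γ ∣
    principal γ i j = B (enum F γ i) (enum F γ j)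

    -- A nonzero minor of B[α,β] makes the columns indexed by α independent: for x
    -- supported on α with Bx = 0, symmetry turns x restricted to α into a row
    -- relation of B[α,β].
    minor≉0⇒independent : ∀ α β (e : ∣ α ∣ ≡ ∣ β ∣) → ¬ (minor F B α β e ≈ 0#) → ColumnsIndependent F B α
    minor≉0⇒independent α β e minor≉0 x x≈0 Bx≈0 m with m ∈? α
    ... | no  m∉α = x≈0 m m∉α
    ... | yes m∈α with enum-onto α m m∈α
    ...   | i , Eq.refl = det≉0⇒rowsIndependent _ minor≉0 (x ∘ enum F α) rowRelation i
      where
      rowRelation : ∀ j → ∑ F (λ i → x (enum F α i) * B (enum F α i) (enum F β (cast e j))) ≈ 0#
      rowRelation j = begin
        ∑ F (λ i → x (enum F α i) * B (enum F α i) (enum F β (cast e j)))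
          ≈⟨ ∑-cong (λ i → trans (*-comm _ _) (*-congʳ (symmetric (enum F α i) (enum F β (cast e j))))) ⟩
        (B (enum F β (cast e j)) ∘ enum F α) · (x ∘ enum F α)
          ≈⟨ ·-onSupport α (B (enum F β (cast e j))) x x≈0 ⟨
        B (enum F β (cast e j)) · x
          ≈⟨ Bx≈0 _ ⟩
        0# ∎

    -- Enlarging an independent γ: if x is supported on γ and Bx vanishes on γ but not
    -- at l, then γ ∪ {l} is independent, since a kernel vector c supported there has
    -- 0 = xᵀ B c = cᵀ B x = c_l (Bx)_l.
    extend-independent : ∀ γ → ColumnsIndependent F B γ → ∀ x → (∀ m → m ∉ γ → x m ≈ 0#) →
      (∀ m → m ∈ γ → B m · x ≈ 0#) → ∀ l → ¬ (B l · x ≈ 0#) → ColumnsIndependent F B (γ ∪ ⁅ l ⁆)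
    extend-independent γ independent x x≈0 Bx≈0 l Bₗx≉0 c c≈0 Bc≈0 = independent c c≈0′ Bc≈0
      where
      cᵢBx≈0 : ∀ p → ¬ (p ≡ l) → c p * (B p · x) ≈ 0#
      cᵢBx≈0 p p≢l with p ∈? γ
      ... | yes p∈γ = trans (*-congˡ (Bx≈0 p p∈γ)) (zeroʳ _)
      ... | no  p∉γ = trans (*-congʳ (c≈0 p (∉γ∪l γ l p p∉γ p≢l))) (zeroˡ _)
      cₗ≈0 : c l ≈ 0#
      cₗ≈0 = cancelNonzero (B l · x) (c l) Bₗx≉0 (trans (*-comm _ _) (begin
        c l * (B l · x)              ≈⟨ ∑-single (λ p → c p * (B p · x)) l cᵢBx≈0 ⟨
        c · (λ p → B p · x)          ≈⟨ ·-symmetric B symmetric c x ⟩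
        x · (λ m → B m · c)          ≈⟨ ∑-zero (λ m → x m * (B m · c)) (λ m → trans (*-congˡ (Bc≈0 m)) (zeroʳ _)) ⟩
        0#                           ∎))
      c≈0′ : ∀ m → m ∉ γ → c m ≈ 0#
      c≈0′ m m∉γ with m Fin.≟ l
      ... | yes Eq.refl = cₗ≈0
      ... | no  m≢l     = c≈0 m (∉γ∪l γ l m m∉γ m≢l)

    -- For a maximal independent γ the principal submatrix B[γ,γ] has trivial kernel:
    -- a kernel vector y, extended by zero, has Bx = 0 on γ, and off γ as well since
    -- otherwise γ could be enlarged.
    maximal⇒trivialKernel : ∀ γ → ColumnsIndependent F B γ →
      (∀ δ → ColumnsIndependent F B δ → ∣ δ ∣ ≤ ∣ γ ∣) → TrivialKernel (principal γ)
    maximal⇒trivialKernel γ independent maximal y By≈0 y≉0 =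
      ¬¬-∀ (λ l → B l · x ≈ 0#) Bx≈0 λ Bx≈0 →
        y≉0 λ j → trans (reflexive (Eq.sym (extendByZero-enum γ y j))) (independent x x≈0 Bx≈0 (enum F γ j))
      where
      x = extendByZero γ y
      x≈0 : ∀ m → m ∉ γ → x m ≈ 0#
      x≈0 = extendByZero-off γ y
      Bx≈0-onγ : ∀ m → m ∈ γ → B m · x ≈ 0#
      Bx≈0-onγ m m∈γ with enum-onto γ m m∈γ
      ... | i , Eq.refl = begin
        B (enum F γ i) · x                          ≈⟨ ·-onSupport γ (B (enum F γ i)) x x≈0 ⟩
        (B (enum F γ i) ∘ enum F γ) · (x ∘ enum F γ) ≈⟨ ∑-cong (λ j → *-congˡ (reflexive (extendByZero-enum γ y j))) ⟩
        principal γ i · y                           ≈⟨ By≈0 i ⟩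
        0#                                          ∎
      Bx≈0 : ∀ l → ¬ ¬ (B l · x ≈ 0#)
      Bx≈0 l Bₗx≉0 with l ∈? γ
      ... | yes l∈γ = Bₗx≉0 (Bx≈0-onγ l l∈γ)
      ... | no  l∉γ = ℕP.<⇒≱ (∣γ∣<∣γ∪l∣ γ l l∉γ)
                        (maximal _ (extend-independent γ independent x x≈0 Bx≈0-onγ l Bₗx≉0))

    qpMinor-principal : ∀ k γ (q : QuasiPrincipal F k γ γ) → qpMinor F B γ γ q ≈ det F (principal γ)
    qpMinor-principal k γ q = det-cong λ i j → reflexive (Eq.cong (B (enum F γ i) ∘ enum F γ) (FinP.cast-is-id _ j))

    -- The only quasi-principal submatrix of order n is B itself, so q_n is never S.
    lastLetter : ∀ t → QprTerm F B n t → t ≡ N ⊎ t ≡ A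
    lastLetter N _ = inj₁ Eq.refl
    lastLetter A _ = inj₂ Eq.refl
    lastLetter S ((α , β , q , minor≉0) , (α′ , β′ , q′ , minor≈0)) = contradiction (sameMinor α β α′ β′ q q′ minor≈0) minor≉0
      where
      sameMinor : ∀ α β α′ β′ (q : QuasiPrincipal F n α β) (q′ : QuasiPrincipal F n α′ β′) →
        qpMinor F B α′ β′ q′ ≈ 0# → qpMinor F B α β q ≈ 0#
      sameMinor α β α′ β′ q q′ minor≈0
        with ∣p∣≡n⇒p≡⊤ {p = α} (proj₁ q) | ∣p∣≡n⇒p≡⊤ {p = β} (proj₁ (proj₂ q))
           | ∣p∣≡n⇒p≡⊤ {p = α′} (proj₁ q′) | ∣p∣≡n⇒p≡⊤ {p = β′} (proj₁ (proj₂ q′))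
      ... | Eq.refl | Eq.refl | Eq.refl | Eq.refl = minor≈0

    module Rank {r} (rank : IsRank F B r) where

      -- A maximal independent set of columns γ (of size r) gives a nonzero principal minor.
      principalMinor≉0 : Σ (Subset n) λ γ → ∣ γ ∣ ≡ r × ¬ (det F (principal γ) ≈ 0#)
      principalMinor≉0 with proj₁ rank
      ... | γ , ∣γ∣≡r , independent =
        γ , ∣γ∣≡r , trivialKernel⇒det≉0 (principal γ) (maximal⇒trivialKernel γ independent maximal)
        where
        maximal : ∀ δ → ColumnsIndependent F B δ → ∣ δ ∣ ≤ ∣ γ ∣
        maximal δ δ-independent = Eq.subst (∣ δ ∣ ≤_) (Eq.sym ∣γ∣≡r) (proj₂ rank δ δ-independent)

      -- No quasi-principal minor of order k > r is nonzero: its columns would be independent.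
      minorAbove≈0 : ∀ k → r < k → ∀ α β (q : QuasiPrincipal F k α β) → ¬ ¬ (qpMinor F B α β q ≈ 0#)
      minorAbove≈0 k r<k α β q minor≉0 = ℕP.<⇒≱ r<k
        (Eq.subst (_≤ r) (proj₁ q) (proj₂ rank α (minor≉0⇒independent α β (sizeEq F α β q) minor≉0)))

      letterAtRank : ∀ t → QprTerm F B r t → t ≡ A ⊎ t ≡ S
      letterAtRank A _ = inj₁ Eq.refl
      letterAtRank S _ = inj₂ Eq.refl
      letterAtRank N allZero with principalMinor≉0
      ... | γ , ∣γ∣≡r , det≉0 =
        contradiction (trans (sym (qpMinor-principal r γ q)) (allZero γ γ q)) det≉0
        where q = principal-quasiPrincipal r γ ∣γ∣≡r

      lettersAbove : ∀ k t → r < k → k ≤ n → QprTerm F B k t → t ≡ N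
      lettersAbove k A r<k k≤n allNonzero =
        contradiction (allNonzero α α q) (minorAbove≈0 k r<k α α q)
        where
        α = initialSegment k k≤n
        q = principal-quasiPrincipal k α (∣initialSegment∣ k k≤n)
      lettersAbove k S r<k k≤n ((α , β , q , minor≉0) , _) = contradiction minor≉0 (minorAbove≈0 k r<k α β q)
      lettersAbove k N r<k k≤n _ = Eq.refl

mainTheorem1 : {c ℓ : Level} (F : Field c ℓ) (n : ℕ) (B : Matrix F n n) →
    IsSymmetric F B →
    (1 ≤ n → ∀ t → QprTerm F B n t → t ≡ N ⊎ t ≡ A)
    ×
    (∀ r → IsRank F B r →
    (1 ≤ r → ∀ t → QprTerm F B r t → t ≡ A ⊎ t ≡ S)
    × (∀ k t → r < k → k ≤ n → QprTerm F B k t → t ≡ N))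
mainTheorem1 F n B symmetric =
  (λ _ → lastLetter) , λ r rank → (λ _ → Rank.letterAtRank rank) , Rank.lettersAbove rank
  where open LinearAlgebra.Symmetric F B symmetric
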